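{- Let $X=(x_1,\ldots,x_m)$ and $Y=(y_1,\ldots,y_n)$ be sequences of Boolean variables, let $\Phi(c_1),\ldots,\Phi(c_r)$ be Boolean formulas over $X\cup Y$, let $\mathsf{op}$ be an $r$-ary Boolean operator, and let $\Phi(N)=\mathsf{op}(\Phi(c_1),\ldots,\Phi(c_r))$. Let $z_1,\ldots,z_r$ be fresh Boolean variables ordered $z_1\prec z_2\prec\cdots\prec z_r$, and view $\mathsf{op}$ as the formula $\mathsf{op}(z_1,\ldots,z_r)$. For each $l\in\{1,\ldots,r\}$, let $\widetilde{\Delta}_{z_l}(\mathsf{op})$ and $\widetilde{\Gamma}_{z_l}(\mathsf{op})$ be formulas in negation normal form with variables among $\{z_{l+1},\ldots,z_r\}$ that are refinements of $\Delta_{z_l}(\mathsf{op})$ and $\Gamma_{z_l}(\mathsf{op})$ respectively. Let $\Omega_{l,\mathsf{op}}$ (resp. $\Upsilon_{l,\mathsf{op}}$) be the formula obtained from $\widetilde{\Delta}_{z_l}(\mathsf{op})$ (resp. $\widetilde{\Gamma}_{z_l}(\mathsf{op})$) by replacing every literal $\neg z_s$ by a fresh variable $\overline{z_s}$. For each $i\in\{1,\ldots,n\}$ and $j\in\{1,\ldots,r\}$, let $\widetilde{\Delta}_i(c_j),\widetilde{\Delta}_i(\neg c_j),\widetilde{\Gamma}_i(c_j),\widetilde{\Gamma}_i(\neg c_j)$ be refinements of $\Delta_i(c_j),\Delta_i(\neg c_j),\Gamma_i(c_j),\Gamma_i(\neg c_j)$ respectively. For a formula $\Psi$ over $\{z_{l+1},\overline{z_{l+1}},\ldots,z_r,\overline{z_r}\}$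 and formulas $A_s,B_s$, write $\Psi\langle A,B\rangle_l$ for the formula obtained from $\Psi$ by simultaneously substituting $A_s$ for $z_s$ and $B_s$ for $\overline{z_s}$ for every $s\in\{l+1,\ldots,r\}$. Then for each $1\le i\le n$ and $1\le l\le r$ the following implications are valid: 1. $\widetilde{\Delta}_i(c_l)\wedge \Omega_{l,\mathsf{op}}\langle \widetilde{\Delta}_i(\neg c),\widetilde{\Delta}_i(c)\rangle_l \rightarrow \Delta_i(N)$; 2. $\widetilde{\Delta}_i(\neg c_l)\wedge \Upsilon_{l,\mathsf{op}}\langle \widetilde{\Delta}_i(\neg c),\widetilde{\Delta}_i(c)\rangle_l \rightarrow \Delta_i(N)$; 3. $\widetilde{\Gamma}_i(c_l)\wedge \Omega_{l,\mathsf{op}}\langle \widetilde{\Gamma}_i(\neg c),\widetilde{\Gamma}_i(c)\rangle_l \rightarrow \Gamma_i(N)$; 4. $\widetilde{\Gamma}_i(\neg c_l)\wedge \Upsilon_{l,\mathsf{op}}\langle \widetilde{\Gamma}_i(\neg c),\widetilde{\Gamma}_i(c)\rangle_l \rightarrow \Gamma_i(N)$, where $\langle \widetilde{\Delta}_i(\neg c),\widetilde{\Delta}_i(c)\rangle_l$ means $A_s=\widetilde{\Delta}_i(\neg c_s)$, $B_s=\widetilde{\Delta}_i(c_s)$, and similarly for $\widetilde{\Gamma}$. Moreover, the same four implications hold with $\mathsf{op}$ replaced by $\neg\mathsf{op}$ (i.e., using $\Omega_{l,\neg\mathsf{op}}$, $\Upsilon_{l,\neg\mathsf{op}}$ built from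 refinements of $\Delta_{z_l}(\neg\mathsf{op})$, $\Gamma_{z_l}(\neg\mathsf{op})$) and with $\Delta_i(N),\Gamma_i(N)$ replaced by $\Delta_i(\neg N),\Gamma_i(\neg N)$.
   Context: For a Boolean formula $\varphi$ and an ordered sequence of variables $w_1,\ldots,w_p$, define $\Delta_{w_i}(\varphi)=\big(\neg\exists w_1\ldots\exists w_{i-1}\,\varphi\big)[w_i\mapsto 0]$ and $\Gamma_{w_i}(\varphi)=\big(\neg\exists w_1\ldots\exists w_{i-1}\,\varphi\big)[w_i\mapsto 1]$, where $[w\mapsto b]$ denotes substitution of the constant $b$. With respect to the sequence $Y=(y_1,\ldots,y_n)$ we write $\Delta_i(\varphi)=\Delta_{y_i}(\varphi)$, $\Gamma_i(\varphi)=\Gamma_{y_i}(\varphi)$; for a formula named $\Phi(M)$ we write $\Delta_i(M)$, $\Gamma_i(M)$ for $\Delta_i(\Phi(M))$, $\Gamma_i(\Phi(M))$, and $\neg M$ stands for $\neg\Phi(M)$. With respect to the sequence $z_1,\ldots,z_r$ we use $\Delta_{z_l}$, $\Gamma_{z_l}$. A formula $g$ is a refinement of $f$ if $g\rightarrow f$ is valid. Negation normal form (NNF) means negations occur only on variables. -}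

module Defs where

open import Data.Bool using (Bool; true; false; not; _∧_; _∨_; if_then_else_)
open import Data.Fin using (Fin; zero; suc; _<_)
open import Data.Fin.Properties using () renaming (_≟_ to _≟F_)
open import Data.Nat using (ℕ)
open import Data.List using (List; []; _∷_; map; foldr)
open import Data.Sum using (_⊎_; inj₁; inj₂; [_,_])
open import Data.Sum.Properties using (≡-dec)
open import Data.Unit using (⊤)
open import Data.Product using (_×_)
open import Relation.Binary.PropositionalEquality using (_≡_)
open import Relation.Binary.Definitions using (DecidableEquality)
open import Relation.Nullary.Decidable using (⌊_⌋)

infixr 6 _∧f_
infixr 5 _∨f_
infixr 4 _⇒f_

data Fm (V : Set) : Set where
  ⊤f ⊥f : Fm V
  var   : V → Fm V
  ¬f    : Fm V → Fm V
  _∧f_  : Fm V → Fm V → Fm V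
  _∨f_  : Fm V → Fm V → Fm V

_⇒f_ : {V : Set} → Fm V → Fm V → Fm V
φ ⇒f ψ = ¬f φ ∨f ψ

eval : {V : Set} → (V → Bool) → Fm V → Bool
eval ρ ⊤f = true
eval ρ ⊥f = false
eval ρ (var v) = ρ v
eval ρ (¬f φ) = not (eval ρ φ)
eval ρ (φ ∧f ψ) = eval ρ φ ∧ eval ρ ψ
eval ρ (φ ∨f ψ) = eval ρ φ ∨ eval ρ ψ

Valid : {V : Set} → Fm V → Set
Valid {V} φ = (ρ : V → Bool) → eval ρ φ ≡ true

Refines : {V : Set} → Fm V → Fm V → Set
Refines g f = Valid (g ⇒f f)

substF : {V W : Set} → (V → Fm W) → Fm V → Fm W
substF σ ⊤f = ⊤f
substF σ ⊥f = ⊥f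
substF σ (var v) = σ v
substF σ (¬f φ) = ¬f (substF σ φ)
substF σ (φ ∧f ψ) = substF σ φ ∧f substF σ ψ
substF σ (φ ∨f ψ) = substF σ φ ∨f substF σ ψ

constF : {V : Set} → Bool → Fm V
constF true = ⊤f
constF false = ⊥f

substConst : {V : Set} → DecidableEquality V → Fm V → V → Bool → Fm V
substConst _≟_ φ w b = substF (λ v → if ⌊ v ≟ w ⌋ then constF b else var v) φ

existsF : {V : Set} → DecidableEquality V → V → Fm V → Fm V
existsF dec w φ = substConst dec φ w false ∨f substConst dec φ w true

existsList : {V : Set} → DecidableEquality V → List V → Fm V → Fm V
existsList dec ws φ = foldr (existsF dec) φ ws

-- the indices strictly before i (0-based), in order
prefix : {p : ℕ} → Fin p → List (Fin p)
prefix zero = []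
prefix (suc i) = zero ∷ map suc (prefix i)

ΔS : {V : Set} {p : ℕ} → DecidableEquality V → (Fin p → V) → Fin p → Fm V → Fm V
ΔS dec w i φ = substConst dec (¬f (existsList dec (map w (prefix i)) φ)) (w i) false

ΓS : {V : Set} {p : ℕ} → DecidableEquality V → (Fin p → V) → Fin p → Fm V → Fm V
ΓS dec w i φ = substConst dec (¬f (existsList dec (map w (prefix i)) φ)) (w i) true

data IsNNF {V : Set} : Fm V → Set where
  nnf-⊤   : IsNNF ⊤f
  nnf-⊥   : IsNNF ⊥f
  nnf-var : ∀ v → IsNNF (var v)
  nnf-neg : ∀ v → IsNNF (¬f (var v))
  nnf-∧   : ∀ {φ ψ} → IsNNF φ → IsNNF ψ → IsNNF (φ ∧f ψ)
  nnf-∨   : ∀ {φ ψ} → IsNNF φ → IsNNF ψ → IsNNF (φ ∨f ψ)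

VarsIn : {V : Set} → (V → Set) → Fm V → Set
VarsIn P ⊤f = ⊤
VarsIn P ⊥f = ⊤
VarsIn P (var v) = P v
VarsIn P (¬f φ) = VarsIn P φ
VarsIn P (φ ∧f ψ) = VarsIn P φ × VarsIn P ψ
VarsIn P (φ ∨f ψ) = VarsIn P φ × VarsIn P ψ

-- replace every literal ¬z_s by the fresh variable  z̄_s = inj₂ s ;  z_s becomes inj₁ s
barify : {V : Set} → Fm V → Fm (V ⊎ V)
barify ⊤f = ⊤f
barify ⊥f = ⊥f
barify (var v) = var (inj₁ v)
barify (¬f (var v)) = var (inj₂ v)
barify (¬f ⊤f) = ¬f ⊤f
barify (¬f ⊥f) = ¬f ⊥f
barify (¬f (¬f φ)) = ¬f (barify (¬f φ))
barify (¬f (φ ∧f ψ)) = ¬f (barify (φ ∧f ψ))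
barify (¬f (φ ∨f ψ)) = ¬f (barify (φ ∨f ψ))
barify (φ ∧f ψ) = barify φ ∧f barify ψ
barify (φ ∨f ψ) = barify φ ∨f barify ψ

plug : {V : Set} {r : ℕ} → Fm (Fin r ⊎ Fin r) → (Fin r → Fm V) → (Fin r → Fm V) → Fm V
plug Ψ A B = substF [ A , B ] Ψ

-- The setting: variables X ∪ Y = Fin m ⊎ Fin n, with y_k = inj₂ k

XY : ℕ → ℕ → Set
XY m n = Fin m ⊎ Fin n

decXY : {m n : ℕ} → DecidableEquality (XY m n)
decXY = ≡-dec _≟F_ _≟F_

ΔY : {m n : ℕ} → Fin n → Fm (XY m n) → Fm (XY m n)
ΔY = ΔS decXY inj₂

ΓY : {m n : ℕ} → Fin n → Fm (XY m n) → Fm (XY m n)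
ΓY = ΓS decXY inj₂

-- Δ_{z_l}, Γ_{z_l} for formulas over z₁ ≺ … ≺ z_r  (z_l = l)
Δz : {r : ℕ} → Fin r → Fm (Fin r) → Fm (Fin r)
Δz = ΔS _≟F_ (λ l → l)

Γz : {r : ℕ} → Fin r → Fm (Fin r) → Fm (Fin r)
Γz = ΓS _≟F_ (λ l → l)

OpRefinements : {r : ℕ} → Fm (Fin r) → (Fin r → Fm (Fin r)) → (Fin r → Fm (Fin r)) → Set
OpRefinements {r} ψ Dt Gt =
  (l : Fin r) →
    (IsNNF (Dt l) × VarsIn (λ s → l < s) (Dt l) × Refines (Dt l) (Δz l ψ)) ×
    (IsNNF (Gt l) × VarsIn (λ s → l < s) (Gt l) × Refines (Gt l) (Γz l ψ))

-- the four implications 1–4 for given i, l, with Ω = barify (Dt l), Υ = barify (Gt l),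
-- and target formula T (T = Φ(N) or ¬Φ(N))
FourImplications : {m n r : ℕ} →
  (Dc Dnc Gc Gnc : Fin n → Fin r → Fm (XY m n)) →
  (Dt Gt : Fin r → Fm (Fin r)) → Fm (XY m n) → Fin n → Fin r → Set
FourImplications Dc Dnc Gc Gnc Dt Gt T i l =
  Valid ((Dc i l ∧f plug (barify (Dt l)) (Dnc i) (Dc i)) ⇒f ΔY i T) ×
  Valid ((Dnc i l ∧f plug (barify (Gt l)) (Dnc i) (Dc i)) ⇒f ΔY i T) ×
  Valid ((Gc i l ∧f plug (barify (Dt l)) (Gnc i) (Gc i)) ⇒f ΓY i T) ×
  Valid ((Gnc i l ∧f plug (barify (Gt l)) (Gnc i) (Gc i)) ⇒f ΓY i T)

-- Fix y_i ↦ b and an assignment ρ.  Δ_i/Γ_i(φ) holds at ρ exactly when φ is false at every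
-- "witness" ρ', i.e. every assignment that agrees with ρ[y_i ↦ b] except on y_1 … y_{i-1}.
-- At a witness ρ' put τ_s := ρ'(c_s); the premises force τ_s = 1 where Δ̃_i(¬c_s) holds and
-- τ_s = 0 where Δ̃_i(c_s) holds, and fix τ_l.  The NNF formula Ω (or Υ) is monotone, so its
-- plugged instance transfers to Δ̃_{z_l}(op) at τ, and since τ is itself a witness for
-- z_l ↦ τ_l, the refinement makes op false at τ, i.e. N false at ρ'.
module Submission where

open import Defs
open import Data.Bool using (Bool; true; false; not; _∧_; _∨_; if_then_else_)
open import Data.Bool.Properties using (∨-conicalˡ; ∨-conicalʳ; ∧-conicalˡ; ∧-conicalʳ; not-injective)
open import Data.Empty using (⊥-elim)
open import Data.Fin using (Fin)
open import Data.Fin.Properties using () renaming (_≟_ to _≟F_)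
open import Data.List using (List; []; _∷_; map)
open import Data.List.Membership.Propositional using (_∈_)
open import Data.List.Relation.Unary.Any using (here; there)
open import Data.Nat using (ℕ)
open import Data.Product using (_×_; _,_; proj₁; proj₂)
open import Data.Sum using (_⊎_; inj₁; inj₂; [_,_])
open import Relation.Binary.Definitions using (DecidableEquality)
open import Relation.Binary.PropositionalEquality using (_≡_; refl; sym; trans; cong; cong₂)
open import Relation.Nullary using (yes; no)
open import Relation.Nullary.Decidable using (⌊_⌋)

eval-cong : {V : Set} {ρ ρ' : V → Bool} → (∀ v → ρ v ≡ ρ' v) →
  (φ : Fm V) → eval ρ φ ≡ eval ρ' φ
eval-cong e ⊤f = refl
eval-cong e ⊥f = refl
eval-cong e (var v) = e v
eval-cong e (¬f φ) = cong not (eval-cong e φ)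
eval-cong e (φ ∧f ψ) = cong₂ _∧_ (eval-cong e φ) (eval-cong e ψ)
eval-cong e (φ ∨f ψ) = cong₂ _∨_ (eval-cong e φ) (eval-cong e ψ)

eval-substF : {V W : Set} (ρ : W → Bool) (σ : V → Fm W) (φ : Fm V) →
  eval ρ (substF σ φ) ≡ eval (λ v → eval ρ (σ v)) φ
eval-substF ρ σ ⊤f = refl
eval-substF ρ σ ⊥f = refl
eval-substF ρ σ (var v) = refl
eval-substF ρ σ (¬f φ) = cong not (eval-substF ρ σ φ)
eval-substF ρ σ (φ ∧f ψ) = cong₂ _∧_ (eval-substF ρ σ φ) (eval-substF ρ σ ψ)
eval-substF ρ σ (φ ∨f ψ) = cong₂ _∨_ (eval-substF ρ σ φ) (eval-substF ρ σ ψ)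

eval-constF : {V : Set} (ρ : V → Bool) (b : Bool) → eval ρ (constF {V} b) ≡ b
eval-constF ρ true = refl
eval-constF ρ false = refl

update : {V : Set} → DecidableEquality V → (V → Bool) → V → Bool → V → Bool
update dec ρ w b v = if ⌊ dec v w ⌋ then b else ρ v

eval-substConst : {V : Set} (dec : DecidableEquality V) (ρ : V → Bool) (φ : Fm V) (w : V) (b : Bool) →
  eval ρ (substConst dec φ w b) ≡ eval (update dec ρ w b) φ
eval-substConst dec ρ φ w b = trans (eval-substF ρ _ φ) (eval-cong eval-pointwise φ)
  where
  eval-pointwise : ∀ v → eval ρ (if ⌊ dec v w ⌋ then constF b else var v) ≡ update dec ρ w b v
  eval-pointwise v with ⌊ dec v w ⌋
  ... | false = refl
  ... | true = eval-constF ρ b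

valid-⇒f : {V : Set} (H G : Fm V) → (∀ ρ → eval ρ H ≡ true → eval ρ G ≡ true) → Valid (H ⇒f G)
valid-⇒f H G h ρ with eval ρ H in eq
... | false = refl
... | true rewrite h ρ eq = refl

refines-true : {V : Set} (H G : Fm V) → Refines H G → ∀ ρ → eval ρ H ≡ true → eval ρ G ≡ true
refines-true H G ref ρ h with ref ρ
... | e rewrite h = e

AgreeOutside : {V : Set} → List V → (V → Bool) → (V → Bool) → Set
AgreeOutside ws ρ ρ' = ∀ v → ρ' v ≡ ρ v ⊎ v ∈ ws

update-self : {V : Set} (dec : DecidableEquality V) (ρ : V → Bool) {w : V} {b : Bool} →
  ρ w ≡ b → (ws : List V) → AgreeOutside ws (update dec ρ w b) ρ
update-self dec ρ {w} ρw≡b ws v with dec v w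
... | yes refl = inj₁ ρw≡b
... | no _ = inj₁ refl

existsList-false⇒ : {V : Set} (dec : DecidableEquality V) (ws : List V) (φ : Fm V) (ρ : V → Bool) →
  eval ρ (existsList dec ws φ) ≡ false → ∀ ρ' → AgreeOutside ws ρ ρ' → eval ρ' φ ≡ false
existsList-false⇒ dec [] φ ρ e ρ' agree = trans (eval-cong agree-everywhere φ) e
  where
  agree-everywhere : ∀ v → ρ' v ≡ ρ v
  agree-everywhere v with agree v
  ... | inj₁ x = x
  ... | inj₂ ()
existsList-false⇒ dec (w ∷ ws) φ ρ e ρ' agree =
  existsList-false⇒ dec ws φ (update dec ρ w (ρ' w)) branch-false ρ' agree'
  where
  ψ = existsList dec ws φ
  branch-false : eval (update dec ρ w (ρ' w)) ψ ≡ false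
  branch-false with ρ' w
  ... | false = trans (sym (eval-substConst dec ρ ψ w false)) (∨-conicalˡ _ _ e)
  ... | true = trans (sym (eval-substConst dec ρ ψ w true)) (∨-conicalʳ _ _ e)
  agree' : AgreeOutside ws (update dec ρ w (ρ' w)) ρ'
  agree' v with dec v w | agree v
  ... | yes refl | _ = inj₁ refl
  ... | no _ | inj₁ x = inj₁ x
  ... | no v≢w | inj₂ (here v≡w) = ⊥-elim (v≢w v≡w)
  ... | no _ | inj₂ (there v∈ws) = inj₂ v∈ws

existsList-false⇐ : {V : Set} (dec : DecidableEquality V) (ws : List V) (φ : Fm V) (ρ : V → Bool) →
  (∀ ρ' → AgreeOutside ws ρ ρ' → eval ρ' φ ≡ false) → eval ρ (existsList dec ws φ) ≡ false
existsList-false⇐ dec [] φ ρ h = h ρ (λ _ → inj₁ refl)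
existsList-false⇐ dec (w ∷ ws) φ ρ h = cong₂ _∨_ (branch-false false) (branch-false true)
  where
  ψ = existsList dec ws φ
  agree-cons : ∀ b ρ' → AgreeOutside ws (update dec ρ w b) ρ' → AgreeOutside (w ∷ ws) ρ ρ'
  agree-cons b ρ' agree v with dec v w | agree v
  ... | yes v≡w | _ = inj₂ (here v≡w)
  ... | no _ | inj₁ x = inj₁ x
  ... | no _ | inj₂ v∈ws = inj₂ (there v∈ws)
  branch-false : ∀ b → eval ρ (substConst dec ψ w b) ≡ false
  branch-false b = trans (eval-substConst dec ρ ψ w b)
    (existsList-false⇐ dec ws φ _ (λ ρ' agree → h ρ' (agree-cons b ρ' agree)))

ΔΓ : {V : Set} {p : ℕ} → DecidableEquality V → (Fin p → V) → Fin p → Bool → Fm V → Fm V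
ΔΓ dec w i b φ = substConst dec (¬f (existsList dec (map w (prefix i)) φ)) (w i) b

Witness : {V : Set} {p : ℕ} → DecidableEquality V → (Fin p → V) → Fin p → Bool →
  (V → Bool) → (V → Bool) → Set
Witness dec w i b ρ = AgreeOutside (map w (prefix i)) (update dec ρ (w i) b)

module _ {V : Set} {p : ℕ} (dec : DecidableEquality V) (w : Fin p → V) (i : Fin p) (b : Bool) where

  ΔΓ-true⇒ : (φ : Fm V) (ρ : V → Bool) → eval ρ (ΔΓ dec w i b φ) ≡ true →
    ∀ ρ' → Witness dec w i b ρ ρ' → eval ρ' φ ≡ false
  ΔΓ-true⇒ φ ρ e = existsList-false⇒ dec (map w (prefix i)) φ (update dec ρ (w i) b)
    (not-injective (trans (sym (eval-substConst dec ρ (¬f (existsList dec ws φ)) (w i) b)) e))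
    where ws = map w (prefix i)

  ΔΓ-true⇐ : (φ : Fm V) (ρ : V → Bool) →
    (∀ ρ' → Witness dec w i b ρ ρ' → eval ρ' φ ≡ false) → eval ρ (ΔΓ dec w i b φ) ≡ true
  ΔΓ-true⇐ φ ρ h = trans (eval-substConst dec ρ (¬f (existsList dec ws φ)) (w i) b)
    (cong not (existsList-false⇐ dec ws φ (update dec ρ (w i) b) h))
    where ws = map w (prefix i)

barify-sound : {V : Set} {φ : Fm V} → IsNNF φ → (μ : V ⊎ V → Bool) (τ : V → Bool) →
  (∀ s → μ (inj₁ s) ≡ true → τ s ≡ true) → (∀ s → μ (inj₂ s) ≡ true → τ s ≡ false) →
  eval μ (barify φ) ≡ true → eval τ φ ≡ true
barify-sound nnf-⊤ μ τ pos neg e = refl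
barify-sound (nnf-var v) μ τ pos neg e = pos v e
barify-sound (nnf-neg v) μ τ pos neg e rewrite neg v e = refl
barify-sound (nnf-∧ p q) μ τ pos neg e =
  cong₂ _∧_ (barify-sound p μ τ pos neg (∧-conicalˡ _ _ e)) (barify-sound q μ τ pos neg (∧-conicalʳ _ _ e))
barify-sound (nnf-∨ {φ} {ψ} p q) μ τ pos neg e with eval μ (barify φ) in eq
... | true rewrite barify-sound p μ τ pos neg eq = refl
... | false rewrite barify-sound q μ τ pos neg e with eval τ φ
...   | true = refl
...   | false = refl

module Composition {V : Set} {p r : ℕ} (dec : DecidableEquality V) (w : Fin p → V) (i : Fin p) (b : Bool)
  (c : Fin r → Fm V) where

  Forces : Fm V → Fin r → Bool → Set
  Forces H s v = ∀ ρ → eval ρ H ≡ true → ∀ ρ' → Witness dec w i b ρ ρ' → eval ρ' (c s) ≡ v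

  forces-false : (H : Fm V) (s : Fin r) → Refines H (ΔΓ dec w i b (c s)) → Forces H s false
  forces-false H s ref ρ h = ΔΓ-true⇒ dec w i b (c s) ρ (refines-true H (ΔΓ dec w i b (c s)) ref ρ h)

  forces-true : (H : Fm V) (s : Fin r) → Refines H (ΔΓ dec w i b (¬f (c s))) → Forces H s true
  forces-true H s ref ρ h ρ' wit = not-injective (¬c-false ρ' wit)
    where
    ¬c-false = ΔΓ-true⇒ dec w i b (¬f (c s)) ρ (refines-true H (ΔΓ dec w i b (¬f (c s))) ref ρ h)

  ΔΓ-substF : (ψ Ψ : Fm (Fin r)) (l : Fin r) (b' : Bool) (H : Fm V) (A B : Fin r → Fm V) →
    IsNNF Ψ → Refines Ψ (ΔΓ _≟F_ (λ z → z) l b' ψ) →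
    Forces H l b' → (∀ s → Forces (A s) s true) → (∀ s → Forces (B s) s false) →
    Valid ((H ∧f plug (barify Ψ) A B) ⇒f ΔΓ dec w i b (substF c ψ))
  ΔΓ-substF ψ Ψ l b' H A B nnf ref forcesH forcesA forcesB =
    valid-⇒f (H ∧f plug (barify Ψ) A B) (ΔΓ dec w i b (substF c ψ)) λ ρ h →
      ΔΓ-true⇐ dec w i b (substF c ψ) ρ λ ρ' wit →
        trans (eval-substF ρ' c ψ) (ψ-false ρ h ρ' wit)
    where
    ψ-false : ∀ ρ → eval ρ (H ∧f plug (barify Ψ) A B) ≡ true →
      ∀ ρ' → Witness dec w i b ρ ρ' → eval (λ s → eval ρ' (c s)) ψ ≡ false
    ψ-false ρ h ρ' wit = ΔΓ-true⇒ _≟F_ (λ z → z) l b' ψ τ Δψ-true τ τ-witness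
      where
      τ : Fin r → Bool
      τ s = eval ρ' (c s)
      Ψ-true : eval τ Ψ ≡ true
      Ψ-true = barify-sound nnf _ τ (λ s a → forcesA s ρ a ρ' wit) (λ s a → forcesB s ρ a ρ' wit)
        (trans (sym (eval-substF ρ [ A , B ] (barify Ψ))) (∧-conicalʳ _ _ h))
      Δψ-true : eval τ (ΔΓ _≟F_ (λ z → z) l b' ψ) ≡ true
      Δψ-true = refines-true Ψ (ΔΓ _≟F_ (λ z → z) l b' ψ) ref τ Ψ-true
      τ-witness : Witness _≟F_ (λ z → z) l b' τ τ
      τ-witness = update-self _≟F_ τ (forcesH ρ (∧-conicalˡ _ _ h) ρ' wit) (map (λ z → z) (prefix l))

fourImplications : {m n r : ℕ} (c : Fin r → Fm (XY m n)) (Dc Dnc Gc Gnc : Fin n → Fin r → Fm (XY m n)) →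
  (i : Fin n) →
  ((j : Fin r) →
    Refines (Dc i j) (ΔY i (c j)) × Refines (Dnc i j) (ΔY i (¬f (c j))) ×
    Refines (Gc i j) (ΓY i (c j)) × Refines (Gnc i j) (ΓY i (¬f (c j)))) →
  (ψ : Fm (Fin r)) (D G : Fin r → Fm (Fin r)) → OpRefinements ψ D G →
  (l : Fin r) → FourImplications Dc Dnc Gc Gnc D G (substF c ψ) i l
fourImplications c Dc Dnc Gc Gnc i cR ψ D G opR l =
  Δ.ΔΓ-substF ψ (D l) l false (Dc i l) (Dnc i) (Dc i) D-nnf D-ref (Dc-forces l) Dnc-forces Dc-forces ,
  Δ.ΔΓ-substF ψ (G l) l true (Dnc i l) (Dnc i) (Dc i) G-nnf G-ref (Dnc-forces l) Dnc-forces Dc-forces ,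
  Γ.ΔΓ-substF ψ (D l) l false (Gc i l) (Gnc i) (Gc i) D-nnf D-ref (Gc-forces l) Gnc-forces Gc-forces ,
  Γ.ΔΓ-substF ψ (G l) l true (Gnc i l) (Gnc i) (Gc i) G-nnf G-ref (Gnc-forces l) Gnc-forces Gc-forces
  where
  module Δ = Composition decXY inj₂ i false c
  module Γ = Composition decXY inj₂ i true c
  Dc-forces : ∀ s → Δ.Forces (Dc i s) s false
  Dc-forces s = Δ.forces-false (Dc i s) s (proj₁ (cR s))
  Dnc-forces : ∀ s → Δ.Forces (Dnc i s) s true
  Dnc-forces s = Δ.forces-true (Dnc i s) s (proj₁ (proj₂ (cR s)))
  Gc-forces : ∀ s → Γ.Forces (Gc i s) s false
  Gc-forces s = Γ.forces-false (Gc i s) s (proj₁ (proj₂ (proj₂ (cR s))))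
  Gnc-forces : ∀ s → Γ.Forces (Gnc i s) s true
  Gnc-forces s = Γ.forces-true (Gnc i s) s (proj₂ (proj₂ (proj₂ (cR s))))
  D-nnf = proj₁ (proj₁ (opR l))
  D-ref = proj₂ (proj₂ (proj₁ (opR l)))
  G-nnf = proj₁ (proj₂ (opR l))
  G-ref = proj₂ (proj₂ (proj₂ (opR l)))

lemma2 : (m n r : ℕ) (c : Fin r → Fm (XY m n)) (op : Fm (Fin r)) →
    (Dt Gt : Fin r → Fm (Fin r)) → OpRefinements op Dt Gt →
    (Dt¬ Gt¬ : Fin r → Fm (Fin r)) → OpRefinements (¬f op) Dt¬ Gt¬ →
    (Dc Dnc Gc Gnc : Fin n → Fin r → Fm (XY m n)) →
    ((i : Fin n) (j : Fin r) →
      Refines (Dc i j) (ΔY i (c j)) × Refines (Dnc i j) (ΔY i (¬f (c j))) ×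
      Refines (Gc i j) (ΓY i (c j)) × Refines (Gnc i j) (ΓY i (¬f (c j)))) →
    (i : Fin n) (l : Fin r) →
      FourImplications Dc Dnc Gc Gnc Dt Gt (substF c op) i l ×
      FourImplications Dc Dnc Gc Gnc Dt¬ Gt¬ (¬f (substF c op)) i l
lemma2 m n r c op Dt Gt opR Dt¬ Gt¬ opR¬ Dc Dnc Gc Gnc cR i l =
  fourImplications c Dc Dnc Gc Gnc i (cR i) op Dt Gt opR l ,
  fourImplications c Dc Dnc Gc Gnc i (cR i) (¬f op) Dt¬ Gt¬ opR¬ l
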